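{- Let $T$ be a tree with distinguishing number $D(T)=2$ and radius at most $2$. Then $2\leq \pi_2^*(T)\leq 6$; in particular $D(T)\leq \pi_2^*(T)$.
   Context: All graphs are finite and simple. For a graph $G=(V,E)$, a pebbling configuration is a function $f:V\to\mathbb{N}\cup\{0\}$ ($f(u)$ is the number of pebbles on $u$), of weight $w(f)=\sum_{u\in V}f(u)$. A pebbling move removes two pebbles from a vertex $u$ and places one pebble on a vertex adjacent to $u$. A configuration $f$ is solvable if for every vertex $v$ there is a (possibly empty) sequence of pebbling moves starting from $f$ that results in at least one pebble on $v$. A configuration $f$ is a $2$-restricted pebbling configuration (2RPC) if $f(u)\le 2$ for all $u\in V$. The $2$-restricted optimal pebbling number $\pi_2^*(G)$ is the minimum weight of a solvable 2RPC on $G$. The distinguishing number $D(G)$ is the smallest $r$ such that there is a labeling $\phi:V\to\{1,\dots,r\}$ for which the only automorphism of $G$ preserving all labels is the identity. -}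

module Defs where

open import Data.Nat using (ℕ; zero; suc; _+_; _∸_; _≤_; _<_)
open import Data.Fin using (Fin; _≟_)
open import Data.Bool using (Bool; true; false; if_then_else_)
open import Data.List using (List; []; _∷_; _++_; [_]; length)
open import Data.List.Relation.Unary.Linked using (Linked)
open import Data.List.Relation.Unary.Unique.Propositional using (Unique)
open import Data.Vec using (sum; tabulate)
open import Data.Product using (Σ; ∃; _×_; _,_)
open import Relation.Nullary using (¬_; does)
open import Relation.Binary.PropositionalEquality using (_≡_)
open import Relation.Binary.Construct.Closure.ReflexiveTransitive using (Star)
open import Function.Definitions using (Injective)

record Graph (n : ℕ) : Set where
  field
    adj   : Fin n → Fin n → Bool
    sym   : ∀ u v → adj u v ≡ adj v u
    irref : ∀ u → adj u u ≡ false

module _ {n : ℕ} (G : Graph n) where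
  open Graph G

  Adj : Fin n → Fin n → Set
  Adj u v = adj u v ≡ true

  Connected : Set
  Connected = ∀ u v → Star Adj u v

  HasCycle : Set
  HasCycle = Σ (Fin n) λ x → Σ (List (Fin n)) λ ys →
    (2 ≤ length ys) × Unique (x ∷ ys) × Linked Adj (x ∷ ys ++ [ x ])

  IsTree : Set
  IsTree = (1 ≤ n) × Connected × ¬ HasCycle

  data Walk : ℕ → Fin n → Fin n → Set where
    here : ∀ {u} → Walk zero u u
    step : ∀ {k u v w} → Adj u v → Walk k v w → Walk (suc k) u w

  DistLe : ℕ → Fin n → Fin n → Set
  DistLe k u v = Σ ℕ λ l → (l ≤ k) × Walk l u v

  RadiusLe : ℕ → Set
  RadiusLe k = Σ (Fin n) λ c → ∀ v → DistLe k c v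

  -- automorphisms (injective self-maps of a finite set are bijections)
  IsAutomorphism : (Fin n → Fin n) → Set
  IsAutomorphism σ = Injective _≡_ _≡_ σ × (∀ u v → adj (σ u) (σ v) ≡ adj u v)

  -- a distinguishing labeling with labels {1..r} (encoded as Fin r)
  IsDistinguishing : {r : ℕ} → (Fin n → Fin r) → Set
  IsDistinguishing φ = ∀ σ → IsAutomorphism σ → (∀ v → φ (σ v) ≡ φ v) → ∀ v → σ v ≡ v

  HasDistLabeling : ℕ → Set
  HasDistLabeling r = Σ (Fin n → Fin r) IsDistinguishing

  DistNumberIs : ℕ → Set
  DistNumberIs r = HasDistLabeling r × (∀ s → s < r → ¬ HasDistLabeling s)

  Config : Set
  Config = Fin n → ℕ

  weight : Config → ℕ
  weight f = sum (tabulate f)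

  -- the result of the pebbling move from u to v (u ≠ v since u ~ v)
  move : Config → Fin n → Fin n → Config
  move f u v w =
    if does (w ≟ u) then f u ∸ 2
    else if does (w ≟ v) then suc (f v)
    else f w

  data Reach : Config → Config → Set where
    done : ∀ {f} → Reach f f
    mv   : ∀ {f g} u v → Adj u v → 2 ≤ f u → Reach (move f u v) g → Reach f g

  Solvable : Config → Set
  Solvable f = ∀ v → Σ Config λ g → Reach f g × (1 ≤ g v)

  Is2RPC : Config → Set
  Is2RPC f = ∀ u → f u ≤ 2

  Pi2StarIs : ℕ → Set
  Pi2StarIs k =
    (Σ Config λ f → Is2RPC f × Solvable f × weight f ≡ k) ×
    (∀ f → Is2RPC f → Solvable f → k ≤ weight f)

-- A centre c of eccentricity at most 2 yields a solvable 2-restricted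
-- configuration of weight at most 6: two pebbles on c and on (up to) two
-- neighbours a₁, a₂ of c. A vertex v at distance 2, reached through a
-- neighbour x of c, is pebbled by the moves a₁ → c, a₂ → c, c → x, c → x,
-- x → v. Conversely, a configuration in which no vertex holds two pebbles
-- admits no move, so it is solvable only if every vertex carries a pebble;
-- since D(T) = 2 excludes the one-vertex tree, every solvable configuration
-- has weight at least 2. Finally π₂*(T) exists
-- because solvability is decidable (each move lowers the weight) and there
-- are finitely many 2-restricted configurations.
module Submission where

open import Defs
open import Level using (0ℓ)
open import Data.Bool using (true; false; if_then_else_)
import Data.Bool.Properties as Bool
open import Data.Empty using (⊥-elim)
open import Data.Fin using (Fin; zero; suc; _≟_)
open import Data.Fin.Properties using (any?; all?)
open import Data.List using (List; []; _∷_; [_]; length)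
open import Data.List.Membership.Propositional using (_∈_)
open import Data.List.Relation.Unary.Any using (here; there)
open import Data.Nat using (ℕ; zero; suc; _+_; _*_; _∸_; _⊔_; _≤_; _<_; z≤n; s≤s; _≤?_)
open import Data.Nat.Induction using (<-wellFounded)
open import Data.Nat.Properties as ℕ
  using (≤-refl; ≤-trans; ≤-reflexive; ≤-pred; +-mono-≤; m≤m+n; m∸n+n≡m; +-identityʳ;
         +-comm; +-suc; +-cancelʳ-≡; *-suc; *-monoʳ-≤; ⊔-lub; m≤m⊔n; m≤n⊔m; m⊔n≤m+n;
         ≮⇒≥; anyUpTo?; module ≤-Reasoning)
open import Algebra.Properties.CommutativeSemigroup ℕ.+-commutativeSemigroup
  using (interchange)
open import Data.Product using (Σ; ∃; _×_; _,_; proj₁; proj₂)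
open import Data.Vec using (sum; tabulate)
import Data.Vec.Functional as Vector
open import Data.Vec.Properties using (tabulate-cong)
open import Function using (_∘_)
open import Induction.WellFounded using (Acc; acc)
open import Relation.Binary.PropositionalEquality
  using (_≡_; _≢_; _≗_; refl; sym; trans; cong; cong₂; subst; module ≡-Reasoning)
open import Relation.Nullary using (¬_; Dec; yes; no; does)
open import Relation.Nullary.Decidable using (map′; _×-dec_; ¬?; dec-true; dec-false)
open import Relation.Unary using (Pred; Decidable)

∑ : ∀ {n} → (Fin n → ℕ) → ℕ
∑ f = sum (tabulate f)

∑-cong : ∀ {n} {f g : Fin n → ℕ} → f ≗ g → ∑ f ≡ ∑ g
∑-cong f≗g = cong sum (tabulate-cong f≗g)

∑-mono-≤ : ∀ {n} {f g : Fin n → ℕ} → (∀ x → f x ≤ g x) → ∑ f ≤ ∑ g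
∑-mono-≤ {zero}  f≤g = z≤n
∑-mono-≤ {suc n} f≤g = +-mono-≤ (f≤g zero) (∑-mono-≤ (f≤g ∘ suc))

∑-+ : ∀ {n} (f g : Fin n → ℕ) → ∑ (λ x → f x + g x) ≡ ∑ f + ∑ g
∑-+ {zero}  f g = refl
∑-+ {suc n} f g = trans (cong (f zero + g zero +_) (∑-+ (f ∘ suc) (g ∘ suc)))
                        (interchange (f zero) (g zero) (∑ (f ∘ suc)) (∑ (g ∘ suc)))

∑-zero : ∀ n → ∑ {n} (λ _ → 0) ≡ 0
∑-zero zero    = refl
∑-zero (suc n) = ∑-zero n

≤-∑ : ∀ {n} (f : Fin n → ℕ) x → f x ≤ ∑ f
≤-∑ f zero    = m≤m+n (f zero) _
≤-∑ f (suc x) = ≤-trans (≤-∑ (f ∘ suc) x) (ℕ.m≤n+m _ (f zero))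

δ : ∀ {n} → Fin n → ℕ → Fin n → ℕ
δ a k w = if does (w ≟ a) then k else 0

δ-self : ∀ {n} (a : Fin n) k → δ a k a ≡ k
δ-self a k rewrite dec-true (a ≟ a) refl = refl

δ-other : ∀ {n} {a w : Fin n} k → w ≢ a → δ a k w ≡ 0
δ-other {a = a} {w} k w≢a rewrite dec-false (w ≟ a) w≢a = refl

δ-≤ : ∀ {n} (a : Fin n) k w → δ a k w ≤ k
δ-≤ a k w with does (w ≟ a)
... | true  = ≤-refl
... | false = z≤n

∑-δ : ∀ {n} (a : Fin n) k → ∑ (δ a k) ≡ k
∑-δ {suc n} zero    k = trans (cong (k +_) (∑-zero n)) (+-identityʳ k)
∑-δ {suc n} (suc a) k = ∑-δ a k

twoOn : ∀ {n} → List (Fin n) → Fin n → ℕ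
twoOn []       w = 0
twoOn (a ∷ as) w = δ a 2 w ⊔ twoOn as w

twoOn-≤2 : ∀ {n} (as : List (Fin n)) w → twoOn as w ≤ 2
twoOn-≤2 []       w = z≤n
twoOn-≤2 (a ∷ as) w = ⊔-lub (δ-≤ a 2 w) (twoOn-≤2 as w)

∈⇒2≤twoOn : ∀ {n} (as : List (Fin n)) {w} → w ∈ as → 2 ≤ twoOn as w
∈⇒2≤twoOn (w ∷ _)  (here refl)  = ≤-trans (≤-reflexive (sym (δ-self w 2))) (m≤m⊔n _ _)
∈⇒2≤twoOn (a ∷ as) {w} (there w∈as) = ≤-trans (∈⇒2≤twoOn as w∈as) (m≤n⊔m (δ a 2 w) _)

∑-twoOn : ∀ {n} (as : List (Fin n)) → ∑ (twoOn as) ≤ 2 * length as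
∑-twoOn {n} []       = ≤-reflexive (∑-zero n)
∑-twoOn     (a ∷ as) = begin
  ∑ (twoOn (a ∷ as))                 ≤⟨ ∑-mono-≤ (λ w → m⊔n≤m+n (δ a 2 w) (twoOn as w)) ⟩
  ∑ (λ w → δ a 2 w + twoOn as w)     ≡⟨ ∑-+ (δ a 2) (twoOn as) ⟩
  ∑ (δ a 2) + ∑ (twoOn as)           ≤⟨ +-mono-≤ (≤-reflexive (∑-δ a 2)) (∑-twoOn as) ⟩
  2 + 2 * length as                  ≡⟨ *-suc 2 (length as) ⟨
  2 * length (a ∷ as)                ∎
  where open ≤-Reasoning

any-bounded? : ∀ n b (Q : Pred (Fin n → ℕ) 0ℓ) → (∀ {f g} → f ≗ g → Q f → Q g) →
               Decidable Q →
               Dec (Σ (Fin n → ℕ) λ f → (∀ u → f u ≤ b) × Q f)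
any-bounded? zero b Q Q-resp Q? =
  map′ (λ q → empty , (λ ()) , q) (λ (f , _ , q) → Q-resp (λ ()) q) (Q? empty)
  where
  empty : Fin 0 → ℕ
  empty ()
any-bounded? (suc n) b Q Q-resp Q? = map′ to from (anyUpTo? extends? (suc b))
  where
  Extends : ℕ → Set
  Extends a = Σ (Fin n → ℕ) λ h → (∀ u → h u ≤ b) × Q (a Vector.∷ h)
  extends? : Decidable Extends
  extends? a = any-bounded? n b (Q ∘ (a Vector.∷_))
    (λ h≗h′ → Q-resp λ { zero → refl ; (suc u) → h≗h′ u }) (Q? ∘ (a Vector.∷_))
  to : (∃ λ a → a < suc b × Extends a) → Σ (Fin (suc n) → ℕ) λ f → (∀ u → f u ≤ b) × Q f
  to (a , a<1+b , h , h≤b , q) = (a Vector.∷ h) , (λ { zero → ≤-pred a<1+b ; (suc u) → h≤b u }) , q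
  from : (Σ (Fin (suc n) → ℕ) λ f → (∀ u → f u ≤ b) × Q f) → ∃ λ a → a < suc b × Extends a
  from (f , f≤b , q) = f zero , s≤s (f≤b zero) , f ∘ suc , f≤b ∘ suc ,
                       Q-resp (λ { zero → refl ; (suc u) → refl }) q

least-witness : ∀ {P : Pred ℕ 0ℓ} → Decidable P → ∀ {k} → P k →
                ∃ λ m → P m × (∀ {j} → P j → m ≤ j)
least-witness {P} P? {k} pk = go k (<-wellFounded k) pk
  where
  go : ∀ k → Acc _<_ k → P k → ∃ λ m → P m × (∀ {j} → P j → m ≤ j)
  go k (acc smaller) pk with anyUpTo? P? k
  ... | yes (j , j<k , pj) = go j (smaller j<k) pj
  ... | no none-below = k , pk , λ pj → ≮⇒≥ λ j<k → none-below (_ , j<k , pj)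

module _ {n : ℕ} (G : Graph n) where
  open Graph G using (adj; irref)

  CanPebble : Config G → Fin n → Set
  CanPebble f v = Σ (Config G) λ g → Reach G f g × 1 ≤ g v

  adj⇒≢ : ∀ {u v} → Adj G u v → u ≢ v
  adj⇒≢ {u} u~v refl with () ← trans (sym u~v) (irref u)

  Adj-sym : ∀ {u v} → Adj G u v → Adj G v u
  Adj-sym {u} {v} u~v = trans (Graph.sym G v u) u~v

  move-source : ∀ f u v → move G f u v u ≡ f u ∸ 2
  move-source f u v rewrite dec-true (u ≟ u) refl = refl

  move-target : ∀ f {u v} → u ≢ v → move G f u v v ≡ suc (f v)
  move-target f {u} {v} u≢v rewrite dec-false (v ≟ u) (u≢v ∘ sym) | dec-true (v ≟ v) refl = refl

  move-other : ∀ f {u v w} → w ≢ u → w ≢ v → move G f u v w ≡ f w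
  move-other f {u} {v} {w} w≢u w≢v rewrite dec-false (w ≟ u) w≢u | dec-false (w ≟ v) w≢v = refl

  move-≥ : ∀ f {u v w} → w ≢ u → f w ≤ move G f u v w
  move-≥ f {u} {v} {w} w≢u = grows (w ≟ v)
    where
    grows : Dec (w ≡ v) → f w ≤ move G f u v w
    grows (yes refl) = ≤-trans (ℕ.n≤1+n (f w)) (≤-reflexive (sym (move-target f (w≢u ∘ sym))))
    grows (no w≢v)   = ≤-reflexive (sym (move-other f w≢u w≢v))

  move-balance : ∀ f {u v} → u ≢ v → 2 ≤ f u → ∀ w → move G f u v w + δ u 2 w ≡ f w + δ v 1 w
  move-balance f {u} {v} u≢v 2≤fu w = balance (w ≟ u) (w ≟ v)
    where
    balance : Dec (w ≡ u) → Dec (w ≡ v) → move G f u v w + δ u 2 w ≡ f w + δ v 1 w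
    balance (yes refl) _ rewrite move-source f u v | δ-self u 2 | δ-other 1 u≢v =
      trans (m∸n+n≡m 2≤fu) (sym (+-identityʳ (f u)))
    balance (no w≢u) (yes refl) rewrite move-target f u≢v | δ-other 2 w≢u | δ-self v 1 =
      trans (+-identityʳ _) (+-comm 1 (f v))
    balance (no w≢u) (no w≢v) rewrite move-other f w≢u w≢v | δ-other 2 w≢u | δ-other 1 w≢v = refl

  weight-move : ∀ f {u v} → u ≢ v → 2 ≤ f u → weight G (move G f u v) + 2 ≡ weight G f + 1
  weight-move f {u} {v} u≢v 2≤fu = begin
    ∑ f′ + 2                      ≡⟨ cong (∑ f′ +_) (∑-δ u 2) ⟨
    ∑ f′ + ∑ (δ u 2)              ≡⟨ ∑-+ f′ (δ u 2) ⟨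
    ∑ (λ w → f′ w + δ u 2 w)      ≡⟨ ∑-cong (move-balance f u≢v 2≤fu) ⟩
    ∑ (λ w → f w + δ v 1 w)       ≡⟨ ∑-+ f (δ v 1) ⟩
    ∑ f + ∑ (δ v 1)               ≡⟨ cong (∑ f +_) (∑-δ v 1) ⟩
    ∑ f + 1                       ∎
    where
    open ≡-Reasoning
    f′ = move G f u v

  weight-move-< : ∀ f {u v} → u ≢ v → 2 ≤ f u → weight G (move G f u v) < weight G f
  weight-move-< f {u} {v} u≢v 2≤fu = ≤-reflexive
    (+-cancelʳ-≡ 1 _ _ (trans (sym (+-suc (∑ (move G f u v)) 1)) (weight-move f u≢v 2≤fu)))

  reachable? : (P : Config G → Set) → (∀ g → Dec (P g)) → ∀ f → Dec (∃ λ g → Reach G f g × P g)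
  reachable? P P? f = go f (<-wellFounded (weight G f))
    where
    Reaches : Config G → Set
    Reaches f = ∃ λ g → Reach G f g × P g
    ReachesAfterMove : Config G → Set
    ReachesAfterMove f = ∃ λ u → ∃ λ v → Adj G u v × 2 ≤ f u × Reaches (move G f u v)
    go : ∀ f → Acc _<_ (weight G f) → Dec (Reaches f)
    go f (acc lighter) with P? f
    ... | yes pf = yes (f , done , pf)
    ... | no ¬pf = map′ (λ (u , v , u~v , 2≤fu , g , r , pg) → g , mv u v u~v 2≤fu r , pg)
                        first-move (any? λ u → any? λ v → after-move? u v)
      where
      after-move? : ∀ u v → Dec (Adj G u v × 2 ≤ f u × Reaches (move G f u v))
      after-move? u v with adj u v Bool.≟ true | 2 ≤? f u
      ... | no ¬u~v | _        = no (¬u~v ∘ proj₁)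
      ... | yes _   | no ¬2≤fu = no (¬2≤fu ∘ proj₁ ∘ proj₂)
      ... | yes u~v | yes 2≤fu = map′ (λ r → u~v , 2≤fu , r) (proj₂ ∘ proj₂)
        (go (move G f u v) (lighter (weight-move-< f (adj⇒≢ u~v) 2≤fu)))
      first-move : Reaches f → ReachesAfterMove f
      first-move (_ , done , pf)               = ⊥-elim (¬pf pf)
      first-move (g , mv u v u~v 2≤fu r , pg) = u , v , u~v , 2≤fu , g , r , pg

  solvable? : ∀ f → Dec (Solvable G f)
  solvable? f = all? λ v → reachable? (λ g → 1 ≤ g v) (λ g → 1 ≤? g v) f

  move-cong : ∀ {f f′} → f ≗ f′ → ∀ u v → move G f u v ≗ move G f′ u v
  move-cong f≗f′ u v w = cong₂ (λ p q → if does (w ≟ u) then p else q) (cong (_∸ 2) (f≗f′ u))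
    (cong₂ (λ p q → if does (w ≟ v) then p else q) (cong suc (f≗f′ v)) (f≗f′ w))

  Reach-≗ : ∀ {f f′ g} → f ≗ f′ → Reach G f g → ∃ λ g′ → Reach G f′ g′ × g ≗ g′
  Reach-≗ {f′ = f′} f≗f′ done = f′ , done , f≗f′
  Reach-≗ f≗f′ (mv u v u~v 2≤fu r) with Reach-≗ (move-cong f≗f′ u v) r
  ... | g′ , r′ , g≗g′ = g′ , mv u v u~v (subst (2 ≤_) (f≗f′ u) 2≤fu) r′ , g≗g′

  Solvable-≗ : ∀ {f f′} → f ≗ f′ → Solvable G f → Solvable G f′
  Solvable-≗ f≗f′ solvable v with solvable v
  ... | g , r , 1≤gv with Reach-≗ f≗f′ r
  ... | g′ , r′ , g≗g′ = g′ , r′ , subst (1 ≤_) (g≗g′ v) 1≤gv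

  SolvableOfWeight : ℕ → Set
  SolvableOfWeight j = Σ (Config G) λ f → Is2RPC G f × Solvable G f × weight G f ≡ j

  solvableOfWeight? : Decidable SolvableOfWeight
  solvableOfWeight? j = any-bounded? n 2 (λ f → Solvable G f × weight G f ≡ j)
    (λ f≗f′ (solvable , weight≡j) →
       Solvable-≗ f≗f′ solvable , trans (sym (∑-cong f≗f′)) weight≡j)
    (λ f → solvable? f ×-dec (weight G f ℕ.≟ j))

  Pi2StarIs-exists : ∀ f → Is2RPC G f → Solvable G f → ∃ λ k → Pi2StarIs G k × k ≤ weight G f
  Pi2StarIs-exists f f-2RPC f-solvable
    with k , witness , k-least ← least-witness solvableOfWeight? (f , f-2RPC , f-solvable , refl)
    = k , (witness , λ g g-2RPC g-solvable → k-least (g , g-2RPC , g-solvable , refl)) ,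
      k-least (f , f-2RPC , f-solvable , refl)

  pebbled-without-moves : ∀ {f v} → (∀ u → ¬ 2 ≤ f u) → CanPebble f v → 1 ≤ f v
  pebbled-without-moves stuck (_ , done , 1≤fv)           = 1≤fv
  pebbled-without-moves stuck (_ , mv u _ _ 2≤fu _ , _) = ⊥-elim (stuck u 2≤fu)

  pebble-after-move : ∀ {f u w v} → Adj G u w → 2 ≤ f u → CanPebble (move G f u w) v → CanPebble f v
  pebble-after-move u~w 2≤fu (g , r , 1≤gv) = g , mv _ _ u~w 2≤fu r , 1≤gv

  pebble-neighbour : ∀ f {u v} → 2 ≤ f u → Adj G u v → CanPebble f v
  pebble-neighbour f {u} {v} 2≤fu u~v =
    move G f u v , mv u v u~v 2≤fu done ,
    subst (1 ≤_) (sym (move-target f (adj⇒≢ u~v))) (s≤s z≤n)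

  pebble-across-hub : ∀ f {c a₁ a₂ x v} → 2 ≤ f c → 2 ≤ f a₁ → 2 ≤ f a₂ → a₂ ≢ a₁ →
    Adj G c a₁ → Adj G c a₂ → Adj G c x → Adj G x v → CanPebble f v
  pebble-across-hub f {c} {a₁} {a₂} {x} 2≤fc 2≤fa₁ 2≤fa₂ a₂≢a₁ c~a₁ c~a₂ c~x x~v =
    pebble-after-move (Adj-sym c~a₁) 2≤fa₁ (pebble-after-move (Adj-sym c~a₂) 2≤f₁a₂
      (pebble-after-move c~x 2≤f₂c (pebble-after-move c~x 2≤f₃c
        (pebble-neighbour f₄ 2≤f₄x x~v))))
    where
    f₁ f₂ f₃ f₄ : Config G
    f₁ = move G f a₁ c
    f₂ = move G f₁ a₂ c
    f₃ = move G f₂ c x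
    f₄ = move G f₃ c x
    2≤f₁a₂ : 2 ≤ f₁ a₂
    2≤f₁a₂ = ≤-trans 2≤fa₂ (move-≥ f a₂≢a₁)
    f₂c≡2+fc : f₂ c ≡ 2 + f c
    f₂c≡2+fc = trans (move-target f₁ (adj⇒≢ c~a₂ ∘ sym))
                     (cong suc (move-target f (adj⇒≢ c~a₁ ∘ sym)))
    2≤f₂c : 2 ≤ f₂ c
    2≤f₂c = subst (2 ≤_) (sym f₂c≡2+fc) (m≤m+n 2 (f c))
    2≤f₃c : 2 ≤ f₃ c
    2≤f₃c = subst (2 ≤_) (sym (trans (move-source f₂ c x) (cong (_∸ 2) f₂c≡2+fc))) 2≤fc
    2≤f₄x : 2 ≤ f₄ x
    2≤f₄x = subst (2 ≤_)
      (sym (trans (move-target f₃ (adj⇒≢ c~x)) (cong suc (move-target f₂ (adj⇒≢ c~x)))))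
      (s≤s (s≤s z≤n))

  hub-solvable : ∀ f c → (∀ v → DistLe G 2 c v) → 2 ≤ f c →
    (∀ {x v} → Adj G c x → Adj G x v → CanPebble f v) → Solvable G f
  hub-solvable f c ecc≤2 2≤fc far v with ecc≤2 v
  ... | _ , _ , here                          = f , done , ≤-trans (s≤s z≤n) 2≤fc
  ... | _ , _ , step c~v here                 = pebble-neighbour f 2≤fc c~v
  ... | _ , _ , step c~x (step x~v here)      = far c~x x~v
  ... | _ , s≤s (s≤s ()) , step _ (step _ (step _ _))

  distance-two-cover : ∀ c → Σ (List (Fin n)) λ L → c ∈ L × length L ≤ 3 ×
    (∀ {x v} → Adj G c x → Adj G x v → CanPebble (twoOn L) v)
  distance-two-cover c with any? (λ a → adj c a Bool.≟ true)
  ... | no isolated = [ c ] , here refl , s≤s z≤n , λ c~x _ → ⊥-elim (isolated (_ , c~x))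
  ... | yes (a₁ , c~a₁) with any? (λ b → (adj c b Bool.≟ true) ×-dec ¬? (b ≟ a₁))
  ...   | yes (a₂ , c~a₂ , a₂≢a₁) = L , here refl , ≤-refl ,
          pebble-across-hub (twoOn L) (∈⇒2≤twoOn L (here refl)) (∈⇒2≤twoOn L (there (here refl)))
            (∈⇒2≤twoOn L (there (there (here refl)))) a₂≢a₁ c~a₁ c~a₂
    where
    L : List (Fin n)
    L = c ∷ a₁ ∷ a₂ ∷ []
  ...   | no only-a₁ = L , here refl , s≤s (s≤s z≤n) , via-a₁
    where
    L : List (Fin n)
    L = c ∷ a₁ ∷ []
    via-a₁ : ∀ {x v} → Adj G c x → Adj G x v → CanPebble (twoOn L) v
    via-a₁ {x} c~x x~v with x ≟ a₁
    ... | yes refl = pebble-neighbour (twoOn L) (∈⇒2≤twoOn L (there (here refl))) x~v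
    ... | no x≢a₁  = ⊥-elim (only-a₁ (x , c~x , x≢a₁))

  radius≤2⇒light-solvable-2RPC : RadiusLe G 2 →
    Σ (Config G) λ f → Is2RPC G f × Solvable G f × weight G f ≤ 6
  radius≤2⇒light-solvable-2RPC (c , ecc≤2) with distance-two-cover c
  ... | L , c∈L , |L|≤3 , far =
    twoOn L , twoOn-≤2 L , hub-solvable (twoOn L) c ecc≤2 (∈⇒2≤twoOn L c∈L) far ,
    ≤-trans (∑-twoOn L) (*-monoʳ-≤ 2 |L|≤3)

solvable⇒2≤weight : ∀ {m} (G : Graph (suc (suc m))) f → Solvable G f → 2 ≤ weight G f
solvable⇒2≤weight G f solvable with any? (λ u → 2 ≤? f u)
... | yes (u , 2≤fu) = ≤-trans 2≤fu (≤-∑ f u)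
... | no no-move = +-mono-≤ (pebbled zero) (≤-trans (pebbled (suc zero)) (m≤m+n _ _))
  where
  pebbled : ∀ v → 1 ≤ f v
  pebbled v = pebbled-without-moves G (λ u 2≤fu → no-move (u , 2≤fu)) (solvable v)

Pi2StarIs⇒2≤ : ∀ {m k} (G : Graph (suc (suc m))) → Pi2StarIs G k → 2 ≤ k
Pi2StarIs⇒2≤ G ((g , _ , g-solvable , refl) , _) = solvable⇒2≤weight G g g-solvable

singleton-hasDistLabeling : (G : Graph 1) → HasDistLabeling G 1
singleton-hasDistLabeling G = (λ _ → zero) , λ σ _ _ v → Fin1-unique (σ v) v
  where
  Fin1-unique : (x y : Fin 1) → x ≡ y
  Fin1-unique zero zero = refl

mainTheorem1 : ∀ {n} (T : Graph n) → IsTree T → DistNumberIs T 2 → RadiusLe T 2 →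
    Σ ℕ λ k → Pi2StarIs T k × (2 ≤ k) × (k ≤ 6)
mainTheorem1 {zero}        T _ _ (() , _)
mainTheorem1 {suc zero}    T _ (_ , fewer-labels-fail) _ =
  ⊥-elim (fewer-labels-fail 1 ≤-refl (singleton-hasDistLabeling T))
mainTheorem1 {suc (suc m)} T _ _ radius≤2 =
  let f , f-2RPC , f-solvable , f≤6 = radius≤2⇒light-solvable-2RPC T radius≤2
      k , π₂*≡k , k≤f = Pi2StarIs-exists T f f-2RPC f-solvable
  in  k , π₂*≡k , Pi2StarIs⇒2≤ T π₂*≡k , ≤-trans k≤f f≤6
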